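{- Let $D$ be a Hamiltonian digraph of odd order and let $C$ be a Hamiltonian cycle of $D$. If every vertex of $D$ is the tail of an even chord of $C$, then $\overrightarrow{pc}(D)\le 2$.
   Context: All digraphs are finite, loopless, without parallel arcs (opposite arcs are allowed). A directed path in an arc-coloured digraph is properly coloured if no two consecutive arcs on it have the same colour. An arc-colouring of $D$ makes $D$ properly connected if for every ordered pair $(u,v)$ of distinct vertices there is a properly coloured directed $uv$-path; $\overrightarrow{pc}(D)$ is the minimum number of colours in such an arc-colouring. For a cycle $C=x_0x_1\dots x_{n-1}x_0$ (indices mod $n$), a chord of $C$ is an arc $x_px_q$ of $D$ with $x_q\ne x_{p+1}$ (and $x_q\ne x_p$); its length is the length of the directed subpath $x_px_{p+1}\dots x_q$ of $C$, and the chord is even if this length is even, odd otherwise. -}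

module Defs where

open import Data.Nat using (ℕ; zero; suc; _+_; _∸_; _%_; _<_)
open import Data.Fin using (Fin; toℕ; fromℕ<)
open import Data.Fin.Properties using ()
open import Data.Nat.DivMod using (m%n<n)
open import Data.Product using (Σ; ∃; _×_; _,_)
open import Data.Vec using (Vec; lookup)
open import Function.Definitions using (Injective)
open import Relation.Binary.PropositionalEquality using (_≡_)
open import Relation.Nullary using (¬_)
open import Level using (0ℓ)

Even : ℕ → Set
Even k = k % 2 ≡ 0

Odd : ℕ → Set
Odd k = k % 2 ≡ 1

-- A digraph on the vertex set Fin n: an arc relation, loopless.
-- (No parallel arcs: arcs are determined by their ends; opposite arcs allowed.)
record Digraph (n : ℕ) : Set₁ where
  field
    Arc      : Fin n → Fin n → Set
    loopless : ∀ v → ¬ Arc v v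
open Digraph public

sucMod : ∀ {m} → Fin (suc m) → Fin (suc m)
sucMod {m} i = fromℕ< (m%n<n (suc (toℕ i)) (suc m))

-- A Hamiltonian cycle x_0 x_1 ... x_{n-1} x_0 of D: an injective
-- (hence bijective) enumeration of the vertices with arcs x_i → x_{i+1 mod n}.
-- A cycle needs at least 2 vertices.
record HamCycle {m : ℕ} (D : Digraph (suc m)) : Set where
  field
    atLeast2 : 1 < suc m
    x        : Fin (suc m) → Fin (suc m)
    inj      : Injective _≡_ _≡_ x
    arcs     : ∀ i → Arc D (x i) (x (sucMod i))
open HamCycle public

Hamiltonian : ∀ {n} → Digraph n → Set
Hamiltonian {zero}  D = Data.Empty.⊥ where import Data.Empty
Hamiltonian {suc m} D = HamCycle D

-- Length of the subpath x_p x_{p+1} ... x_q of the cycle: (q - p) mod n.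
chordLength : ∀ {m} → Fin (suc m) → Fin (suc m) → ℕ
chordLength {m} p q = (toℕ q + suc m ∸ toℕ p) % suc m

EvenChord : ∀ {m} {D : Digraph (suc m)} → HamCycle D → Fin (suc m) → Fin (suc m) → Set
EvenChord {D = D} C p q =
  Arc D (x C p) (x C q) × ¬ (q ≡ sucMod p) × ¬ (q ≡ p) × Even (chordLength p q)

ArcColouring : ∀ {n} → Digraph n → ℕ → Set
ArcColouring {n} D k = (u v : Fin n) → Arc D u v → Fin k

open import Data.Maybe using (Maybe; just; nothing)
open import Data.List using (List; []; _∷_)
open import Data.List.Relation.Unary.Unique.Propositional using (Unique)

Differs : ∀ {k} → Fin k → Maybe (Fin k) → Set
Differs a nothing  = Data.Unit.⊤ where import Data.Unit
Differs a (just b) = ¬ (a ≡ b)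

-- PCWalk D c u w f vs : a directed walk from u to w in D with vertex
-- sequence vs, every consecutive pair of arcs of distinct colour under c;
-- f is the colour of its first arc (nothing for the trivial walk).
data PCWalk {n k} (D : Digraph n) (c : ArcColouring D k)
     : Fin n → Fin n → Maybe (Fin k) → List (Fin n) → Set where
  stop : ∀ {u} → PCWalk D c u u nothing (u ∷ [])
  step : ∀ {u v w f vs} (a : Arc D u v) →
         PCWalk D c v w f vs →
         Differs (c u v a) f →
         PCWalk D c u w (just (c u v a)) (u ∷ vs)

PCPath : ∀ {n k} (D : Digraph n) (c : ArcColouring D k) → Fin n → Fin n → Set
PCPath D c u v = Σ _ λ f → Σ (List _) λ vs → PCWalk D c u v f vs × Unique vs

ProperlyConnected : ∀ {n k} (D : Digraph n) → ArcColouring D k → Set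
ProperlyConnected {n} D c = (u v : Fin n) → ¬ (u ≡ v) → PCPath D c u v

pc≤ : ∀ {n} → Digraph n → ℕ → Set
pc≤ D k = Σ (ArcColouring D k) λ c → ProperlyConnected D c

-- Label the vertices along C as y₀ y₁ … y_{N-1}, starting so that a shortest
-- even chord of C is y_P y₁, jumping over y₀ (so P + L = N + 1 for its length L).
-- Colour every arc by the parity of the label of its tail. A walk whose labels
-- alternate in parity, except possibly across its last arc, is then properly
-- coloured. Along C the labels alternate everywhere but at the arc y_{N-1} y₀
-- (N is odd), and an even chord flips the parity exactly when it jumps over y₀.
-- For a uv-path with u = y_i, v = y_j: if i < j, or j = 0, follow C. Otherwise,
-- if i ≤ P, follow C to y_P, take the chord to y₁ and follow C to y_j; if i > P,
-- the even chord out of y_i is at least as long as the shortest one, hence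
-- jumps over y₀ to some y_t with t < i, and we continue from y_t by induction.
module Submission where

open import Defs
open import Data.Bool using (Bool; true; false; not; _xor_)
open import Data.Bool.Properties
  using (not-involutive; not-¬; not-distribˡ-xor; xor-identityʳ; xor-comm; true-xor)
open import Data.Empty using (⊥-elim)
open import Data.Fin using (Fin; toℕ; punchOut) renaming (zero to fzero)
open import Data.Fin.Properties
  using (2↔Bool; toℕ<n; toℕ-fromℕ<; toℕ-injective; any?; _≟_; injective⇒≤; punchOut-injective)
open import Data.List using (List; allFin)
open import Data.List.Membership.Propositional.Properties using (∈-allFin)
open import Data.List.Relation.Unary.All as All using (All; []; _∷_)
open import Data.List.Relation.Unary.AllPairs using ([]; _∷_)
open import Data.List.Relation.Unary.Unique.Propositional using (Unique)
open import Data.Maybe using (Maybe)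
open import Data.Nat using (ℕ; zero; suc; _+_; _∸_; _%_; _<_; _≤_; z≤n; s≤s; _≤?_; _<?_; NonZero)
open import Data.Nat.DivMod using (m%n<n; %-distribˡ-+; m%n%n≡m%n; [m+n]%n≡m%n; m<n⇒m%n≡m)
open import Data.Nat.Induction using (<-rec)
open import Data.Nat.Properties
  using ( +-identityʳ; +-comm; +-suc; +-assoc; +-∸-assoc; m+[n∸m]≡n; m∸n+n≡m
        ; ≤-refl; ≤-trans; <-trans; ≤-<-trans; <-≤-trans; <-irrefl; <⇒≤; ≤-pred; ≮⇒≥; ≰⇒>; <-cmp
        ; m≤n+m; m≤m+n; n≤1+n; n<1+n; 1+n≰n; +-monoʳ-≤; +-mono-≤; +-monoʳ-<; +-cancelʳ-<; ≤-totalOrder )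
open import Data.Product using (Σ; ∃-syntax; _×_; _,_; proj₁; proj₂)
open import Data.Sum using (_⊎_; inj₁; inj₂)
open import Data.Unit using (⊤; tt)
open import Function.Bundles using (Inverse)
open import Function.Definitions using (Injective; Surjective)
open import Relation.Binary.PropositionalEquality
open import Relation.Nullary using (¬_; yes; no)
open import Relation.Binary.Definitions using (tri<; tri≈; tri>)

import Data.List.Extrema ≤-totalOrder as Extrema

parity : ℕ → Bool
parity zero    = false
parity (suc n) = not (parity n)

parity-+ : ∀ m n → parity (m + n) ≡ parity m xor parity n
parity-+ zero    n = refl
parity-+ (suc m) n = trans (cong not (parity-+ m n)) (not-distribˡ-xor (parity m) (parity n))

parity-+-even : ∀ m {n} → parity n ≡ false → parity (m + n) ≡ parity m
parity-+-even m {n} e = trans (parity-+ m n) (trans (cong (parity m xor_) e) (xor-identityʳ (parity m)))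

parity-+-odd : ∀ m {n} → parity n ≡ true → parity (m + n) ≡ not (parity m)
parity-+-odd m {n} o =
  trans (parity-+ m n) (trans (cong (parity m xor_) o) (trans (xor-comm (parity m) true) (true-xor (parity m))))

parity-suc : ∀ n → parity n ≢ parity (suc n)
parity-suc n = not-¬ refl

parity≡parity[n%2] : ∀ n → parity n ≡ parity (n % 2)
parity≡parity[n%2] zero          = refl
parity≡parity[n%2] (suc zero)    = refl
parity≡parity[n%2] (suc (suc n)) = begin
  parity (2 + n)       ≡⟨ not-involutive (parity n) ⟩
  parity n             ≡⟨ parity≡parity[n%2] n ⟩
  parity (n % 2)       ≡⟨ cong parity ([m+n]%n≡m%n n 2) ⟨
  parity ((n + 2) % 2) ≡⟨ cong (λ k → parity (k % 2)) (+-comm n 2) ⟩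
  parity ((2 + n) % 2) ∎
  where open ≡-Reasoning

Even⇒parity≡false : ∀ {n} → Even n → parity n ≡ false
Even⇒parity≡false {n} e = trans (parity≡parity[n%2] n) (cong parity e)

Odd⇒parity≡true : ∀ {n} → Odd n → parity n ≡ true
Odd⇒parity≡true {n} o = trans (parity≡parity[n%2] n) (cong parity o)

[m+n%d]%d≡[m+n]%d : ∀ m n d .{{_ : NonZero d}} → (m + n % d) % d ≡ (m + n) % d
[m+n%d]%d≡[m+n]%d m n d = begin
  (m + n % d) % d           ≡⟨ %-distribˡ-+ m (n % d) d ⟩
  (m % d + n % d % d) % d   ≡⟨ cong (λ k → (m % d + k) % d) (m%n%n≡m%n n d) ⟩
  (m % d + n % d) % d       ≡⟨ %-distribˡ-+ m n d ⟨
  (m + n) % d               ∎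
  where open ≡-Reasoning

[m%d+n]%d≡[m+n]%d : ∀ m n d .{{_ : NonZero d}} → (m % d + n) % d ≡ (m + n) % d
[m%d+n]%d≡[m+n]%d m n d = begin
  (m % d + n) % d ≡⟨ cong (_% d) (+-comm (m % d) n) ⟩
  (n + m % d) % d ≡⟨ [m+n%d]%d≡[m+n]%d n m d ⟩
  (n + m) % d     ≡⟨ cong (_% d) (+-comm n m) ⟩
  (m + n) % d     ∎
  where open ≡-Reasoning

injective⇒surjective : ∀ {n} {f : Fin n → Fin n} → Injective _≡_ _≡_ f → Surjective _≡_ _≡_ f
injective⇒surjective {suc n} {f} f-inj v with any? (λ i → f i ≟ v)
... | yes (i , fi≡v) = i , λ { refl → fi≡v }
... | no  v∉im = ⊥-elim (1+n≰n (injective⇒≤ punchOut∘f-injective))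
  where
  f≢v : ∀ i → v ≢ f i
  f≢v i v≡fi = v∉im (i , sym v≡fi)
  punchOut∘f-injective : Injective _≡_ _≡_ (λ i → punchOut (f≢v i))
  punchOut∘f-injective eq = f-inj (punchOut-injective (f≢v _) (f≢v _) eq)

argmin : ∀ {n} (f : Fin (suc n) → ℕ) → Σ (Fin (suc n)) λ i → ∀ j → f i ≤ f j
argmin f = Extrema.argmin f fzero (allFin _) ,
           λ j → All.lookup (Extrema.f[argmin]≤f[xs] {f = f} fzero (allFin _)) (∈-allFin j)

module Cycle (m : ℕ) where

  N : ℕ
  N = suc m

  advance : ℕ → Fin N → Fin N
  advance zero    i = i
  advance (suc k) i = sucMod (advance k i)

  toℕ-advance : ∀ k i → toℕ (advance k i) ≡ (toℕ i + k) % N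
  toℕ-advance zero    i = begin
    toℕ i           ≡⟨ m<n⇒m%n≡m (toℕ<n i) ⟨
    toℕ i % N       ≡⟨ cong (_% N) (+-identityʳ (toℕ i)) ⟨
    (toℕ i + 0) % N ∎
    where open ≡-Reasoning
  toℕ-advance (suc k) i = begin
    toℕ (sucMod (advance k i))  ≡⟨ toℕ-fromℕ< _ ⟩
    (1 + toℕ (advance k i)) % N ≡⟨ cong (λ n → (1 + n) % N) (toℕ-advance k i) ⟩
    (1 + (toℕ i + k) % N) % N   ≡⟨ [m+n%d]%d≡[m+n]%d 1 (toℕ i + k) N ⟩
    (1 + (toℕ i + k)) % N       ≡⟨ cong (_% N) (+-suc (toℕ i) k) ⟨
    (toℕ i + suc k) % N         ∎
    where open ≡-Reasoning

  advance-+ : ∀ k l i → advance (k + l) i ≡ advance l (advance k i)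
  advance-+ k zero    i = cong (λ n → advance n i) (+-identityʳ k)
  advance-+ k (suc l) i = trans (cong (λ n → advance n i) (+-suc k l)) (cong sucMod (advance-+ k l i))

  advance-N : ∀ i → advance N i ≡ i
  advance-N i = toℕ-injective (begin
    toℕ (advance N i) ≡⟨ toℕ-advance N i ⟩
    (toℕ i + N) % N   ≡⟨ [m+n]%n≡m%n (toℕ i) N ⟩
    toℕ i % N         ≡⟨ m<n⇒m%n≡m (toℕ<n i) ⟩
    toℕ i             ∎)
    where open ≡-Reasoning

  advance-chordLength : ∀ i j → advance (chordLength i j) i ≡ j
  advance-chordLength i j = toℕ-injective (begin
    toℕ (advance (chordLength i j) i)         ≡⟨ toℕ-advance (chordLength i j) i ⟩
    (toℕ i + (toℕ j + N ∸ toℕ i) % N) % N     ≡⟨ [m+n%d]%d≡[m+n]%d (toℕ i) _ N ⟩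
    (toℕ i + (toℕ j + N ∸ toℕ i)) % N         ≡⟨ cong (_% N) (m+[n∸m]≡n i≤j+N) ⟩
    (toℕ j + N) % N                           ≡⟨ [m+n]%n≡m%n (toℕ j) N ⟩
    toℕ j % N                                 ≡⟨ m<n⇒m%n≡m (toℕ<n j) ⟩
    toℕ j                                     ∎)
    where
    open ≡-Reasoning
    i≤j+N : toℕ i ≤ toℕ j + N
    i≤j+N = ≤-trans (<⇒≤ (toℕ<n i)) (m≤n+m N (toℕ j))

  chordLength-advance : ∀ i k → k < N → chordLength i (advance k i) ≡ k
  chordLength-advance i k k<N = begin
    (toℕ (advance k i) + N ∸ toℕ i) % N    ≡⟨ cong (λ n → (n + N ∸ toℕ i) % N) (toℕ-advance k i) ⟩
    ((toℕ i + k) % N + N ∸ toℕ i) % N      ≡⟨ cong (_% N) (+-∸-assoc ((toℕ i + k) % N) i≤N) ⟩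
    ((toℕ i + k) % N + (N ∸ toℕ i)) % N    ≡⟨ [m%d+n]%d≡[m+n]%d (toℕ i + k) (N ∸ toℕ i) N ⟩
    (toℕ i + k + (N ∸ toℕ i)) % N          ≡⟨ cong (λ n → (n + (N ∸ toℕ i)) % N) (+-comm (toℕ i) k) ⟩
    (k + toℕ i + (N ∸ toℕ i)) % N          ≡⟨ cong (_% N) (+-assoc k (toℕ i) (N ∸ toℕ i)) ⟩
    (k + (toℕ i + (N ∸ toℕ i))) % N        ≡⟨ cong (λ n → (k + n) % N) (m+[n∸m]≡n i≤N) ⟩
    (k + N) % N                            ≡⟨ [m+n]%n≡m%n k N ⟩
    k % N                                  ≡⟨ m<n⇒m%n≡m k<N ⟩
    k                                      ∎
    where
    open ≡-Reasoning
    i≤N : toℕ i ≤ N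
    i≤N = <⇒≤ (toℕ<n i)

  chordLength<N : ∀ i j → chordLength i j < N
  chordLength<N i j = m%n<n (toℕ j + N ∸ toℕ i) N

jump-past-period : ∀ {N k L} → parity N ≡ true → parity L ≡ false → L < N → N ≤ k + L →
                   k + L ∸ N < k × parity k ≢ parity (k + L ∸ N)
jump-past-period {N} {k} {L} N-odd L-even L<N N≤k+L = t<k , k≢t
  where
  t : ℕ
  t = k + L ∸ N
  t+N≡k+L : t + N ≡ k + L
  t+N≡k+L = m∸n+n≡m N≤k+L
  t<k : t < k
  t<k = +-cancelʳ-< N t k (subst (_< k + N) (sym t+N≡k+L) (+-monoʳ-< k L<N))
  k≢t : parity k ≢ parity t
  k≢t e = not-¬ refl (begin
    parity t       ≡⟨ e ⟨
    parity k       ≡⟨ parity-+-even k L-even ⟨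
    parity (k + L) ≡⟨ cong parity t+N≡k+L ⟨
    parity (t + N) ≡⟨ parity-+-odd t N-odd ⟩
    not (parity t) ∎)
    where open ≡-Reasoning

-- A Hamiltonian cycle read as an N-periodic sequence of vertices, with the
-- label in {0, …, N-1} of each vertex.
record Unrolling {m : ℕ} (D : Digraph (suc m)) : Set where
  field
    vertex          : ℕ → Fin (suc m)
    label           : Fin (suc m) → ℕ
    label<N         : ∀ v → label v < suc m
    vertex-label    : ∀ v → vertex (label v) ≡ v
    label-vertex    : ∀ k → k < suc m → label (vertex k) ≡ k
    vertex-periodic : ∀ k → vertex (k + suc m) ≡ vertex k
    vertex-arc      : ∀ k → Arc D (vertex k) (vertex (suc k))

module _ {m : ℕ} {D : Digraph (suc m)} (C : HamCycle D) where
  open Cycle m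

  unroll : Fin N → Unrolling D
  unroll b = record
    { vertex          = λ k → x C (advance k b)
    ; label           = λ v → chordLength b (index v)
    ; label<N         = λ v → chordLength<N b (index v)
    ; vertex-label    = λ v → trans (cong (x C) (advance-chordLength b (index v))) (x-index v)
    ; label-vertex    = λ k k<N → trans (cong (chordLength b) (inj C (x-index (x C (advance k b)))))
                                        (chordLength-advance b k k<N)
    ; vertex-periodic = λ k → cong (x C) (trans (advance-+ k N b) (advance-N _))
    ; vertex-arc      = λ k → arcs C (advance k b)
    }
    where
    index : Fin N → Fin N
    index v = proj₁ (injective⇒surjective (inj C) v)
    x-index : ∀ v → x C (index v) ≡ v
    x-index v = proj₂ (injective⇒surjective (inj C) v) refl

module ParityColouring {m : ℕ} {D : Digraph (suc m)} (U : Unrolling D) where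
  open Unrolling U
  open Inverse 2↔Bool using (to; from; strictlyInverseˡ)

  N : ℕ
  N = suc m

  colouring : ArcColouring D 2
  colouring u _ _ = from (parity (label u))

  -- S bounds the labels used, so that routes can be glued without repeating a vertex.
  record Route (u v : Fin N) (S : ℕ → Set) : Set where
    constructor route
    field
      {first}     : Maybe (Fin 2)
      {vertices}  : List (Fin N)
      walk        : PCWalk D colouring u v first vertices
      distinct    : Unique vertices
      labelled-in : All (λ w → S (label w)) vertices

  toPCPath : ∀ {u v S} → Route u v S → PCPath D colouring u v
  toPCPath (route W uniq _) = _ , _ , W , uniq

  widen : ∀ {u v} {S S′ : ℕ → Set} → (∀ {k} → S k → S′ k) → Route u v S → Route u v S′
  widen S⊆S′ (route W uniq A) = route W uniq (All.map S⊆S′ A)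

  stay : ∀ e → e < N → Route (vertex e) (vertex e) (_≡ e)
  stay e e<N = route stop ([] ∷ []) (label-vertex e e<N ∷ [])

  single : ∀ {a b} → a < N → b < N → a ≢ b → Arc D (vertex a) (vertex b) →
           Route (vertex a) (vertex b) (λ k → k ≡ a ⊎ k ≡ b)
  single {a} {b} a<N b<N a≢b arc =
    route (step arc stop tt) ((ya≢yb ∷ []) ∷ [] ∷ [])
          (inj₁ (label-vertex a a<N) ∷ inj₂ (label-vertex b b<N) ∷ [])
    where
    ya≢yb : vertex a ≢ vertex b
    ya≢yb e = a≢b (trans (sym (label-vertex a a<N)) (trans (cong label e) (label-vertex b b<N)))

  prepend : ∀ {a b w} {S : ℕ → Set} → a < N → b < N → Arc D (vertex a) (vertex b) →
            parity a ≢ parity b → ¬ S a → Route (vertex b) w S → Route (vertex a) w (λ k → k ≡ a ⊎ S k)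
  prepend {a} {b} {S = S} a<N b<N arc a≢b a∉S (route W uniq A) =
    route (step arc W (differs W)) (All.map fresh A ∷ uniq) (inj₁ (label-vertex a a<N) ∷ All.map inj₂ A)
    where
    colours-differ : from (parity (label (vertex a))) ≢ from (parity (label (vertex b)))
    colours-differ e = a≢b (begin
      parity a                              ≡⟨ cong parity (label-vertex a a<N) ⟨
      parity (label (vertex a))             ≡⟨ strictlyInverseˡ _ ⟨
      to (from (parity (label (vertex a)))) ≡⟨ cong to e ⟩
      to (from (parity (label (vertex b)))) ≡⟨ strictlyInverseˡ _ ⟩
      parity (label (vertex b))             ≡⟨ cong parity (label-vertex b b<N) ⟩
      parity b                              ∎)
      where open ≡-Reasoning
    differs : ∀ {w f vs} → PCWalk D colouring (vertex b) w f vs → Differs (colouring (vertex a) _ arc) f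
    differs stop         = tt
    differs (step _ _ _) = colours-differ
    fresh : ∀ {v} → S (label v) → vertex a ≢ v
    fresh s refl = a∉S (subst S (label-vertex a a<N) s)

  forwardThen : ∀ d s e {w} {S : ℕ → Set} → s + d ≡ e → e < N → (∀ k → s ≤ k → k < e → ¬ S k) →
                Route (vertex e) w S → Route (vertex s) w (λ k → (s ≤ k × k < e) ⊎ S k)
  forwardThen zero s e eq e<N _ R with trans (sym (+-identityʳ s)) eq
  ... | refl = widen inj₂ R
  forwardThen (suc d) s e {S = S} eq e<N disjoint R =
    widen merge (prepend s<N 1+s<N (vertex-arc s) (parity-suc s) s∉ R′)
    where
    1+s≤e : suc s ≤ e
    1+s≤e = subst (suc s ≤_) (trans (sym (+-suc s d)) eq) (s≤s (m≤m+n s d))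
    1+s<N : suc s < N
    1+s<N = ≤-<-trans 1+s≤e e<N
    s<N : s < N
    s<N = <-trans (n<1+n s) 1+s<N
    R′ : Route (vertex (suc s)) _ (λ k → (suc s ≤ k × k < e) ⊎ S k)
    R′ = forwardThen d (suc s) e (trans (sym (+-suc s d)) eq) e<N
           (λ k 1+s≤k → disjoint k (≤-trans (n≤1+n s) 1+s≤k)) R
    s∉ : ¬ ((suc s ≤ s × s < e) ⊎ S s)
    s∉ (inj₁ (1+s≤s , _)) = <-irrefl refl 1+s≤s
    s∉ (inj₂ s∈S)         = disjoint s ≤-refl 1+s≤e s∈S
    merge : ∀ {k} → k ≡ s ⊎ ((suc s ≤ k × k < e) ⊎ S k) → (s ≤ k × k < e) ⊎ S k
    merge (inj₁ refl)                 = inj₁ (≤-refl , 1+s≤e)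
    merge (inj₂ (inj₁ (1+s≤k , k<e))) = inj₁ (≤-trans (n≤1+n s) 1+s≤k , k<e)
    merge (inj₂ (inj₂ k∈S))           = inj₂ k∈S

  forward : ∀ s e → s ≤ e → e < N → Route (vertex s) (vertex e) (λ k → s ≤ k × k ≤ e)
  forward s e s≤e e<N = widen merge
    (forwardThen (e ∸ s) s e (m+[n∸m]≡n s≤e) e<N (λ k _ k<e k≡e → <-irrefl k≡e k<e) (stay e e<N))
    where
    merge : ∀ {k} → (s ≤ k × k < e) ⊎ k ≡ e → s ≤ k × k ≤ e
    merge (inj₁ (s≤k , k<e)) = s≤k , <⇒≤ k<e
    merge (inj₂ refl)        = s≤e , ≤-refl

  -- The labels alternate along C except across the arc y_{N-1} y₀, which is
  -- harmless as the last arc of a route.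
  toOrigin : ∀ i → 1 ≤ i → i < N → Route (vertex i) (vertex 0) (λ _ → ⊤)
  toOrigin i 1≤i i<N = widen (λ _ → tt)
    (forwardThen (m ∸ i) i m (m+[n∸m]≡n (≤-pred i<N)) ≤-refl disjoint last)
    where
    m≢0 : m ≢ 0
    m≢0 refl = <-irrefl refl (≤-<-trans 1≤i i<N)
    last : Route (vertex m) (vertex 0) (λ k → k ≡ m ⊎ k ≡ 0)
    last = single ≤-refl (s≤s z≤n) m≢0 (subst (Arc D (vertex m)) (vertex-periodic 0) (vertex-arc m))
    disjoint : ∀ k → i ≤ k → k < m → ¬ (k ≡ m ⊎ k ≡ 0)
    disjoint k _   k<m (inj₁ refl) = <-irrefl refl k<m
    disjoint k i≤k _   (inj₂ refl) = <-irrefl refl (≤-trans 1≤i i≤k)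

  module _ (P : ℕ) (P<N : P < N) (P-even : parity P ≡ false)
           (shortcut : Arc D (vertex P) (vertex 1))
           (wrap : ∀ k → P < k → k < N →
                   ∃[ t ] t < k × parity k ≢ parity t × Arc D (vertex k) (vertex t)) where

    -- A route from y_i back to y_j with labels in Back i avoids every y_k with
    -- k > i and k > P, so such a y_k can be prepended to it.
    Back : ℕ → ℕ → Set
    Back i k = k ≤ i ⊎ k ≤ P

    viaShortcut : ∀ i j → i < N → i ≤ P → 1 ≤ j → j < i → Route (vertex i) (vertex j) (Back i)
    viaShortcut i j i<N i≤P 1≤j j<i =
      widen merge (forwardThen (P ∸ i) i P (m+[n∸m]≡n i≤P) P<N disjoint fromP)
      where
      P≢1 : parity P ≢ parity 1
      P≢1 e = not-¬ refl (trans (sym P-even) e)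
      fromP : Route (vertex P) (vertex j) (λ k → k ≡ P ⊎ (1 ≤ k × k ≤ j))
      fromP = prepend P<N (≤-<-trans 1≤j (<-trans j<i i<N)) shortcut P≢1
                (λ (_ , P≤j) → <-irrefl refl (<-≤-trans (≤-<-trans P≤j j<i) i≤P))
                (forward 1 j 1≤j (<-trans j<i i<N))
      disjoint : ∀ k → i ≤ k → k < P → ¬ (k ≡ P ⊎ (1 ≤ k × k ≤ j))
      disjoint k _   k<P (inj₁ refl)     = <-irrefl refl k<P
      disjoint k i≤k _   (inj₂ (_ , k≤j)) = <-irrefl refl (≤-<-trans (≤-trans i≤k k≤j) j<i)
      merge : ∀ {k} → (i ≤ k × k < P) ⊎ (k ≡ P ⊎ (1 ≤ k × k ≤ j)) → Back i k
      merge (inj₁ (_ , k<P))        = inj₂ (<⇒≤ k<P)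
      merge (inj₂ (inj₁ refl))      = inj₂ ≤-refl
      merge (inj₂ (inj₂ (_ , k≤j))) = inj₁ (≤-trans k≤j (<⇒≤ j<i))

    viaWrap : ∀ i j t → i < N → P < i → j < i → t < i → parity i ≢ parity t →
              Arc D (vertex i) (vertex t) → (j < t → Route (vertex t) (vertex j) (Back t)) →
              Route (vertex i) (vertex j) (Back i)
    viaWrap i j t i<N P<i j<i t<i i≢t arc fromT with j <? t
    ... | yes j<t = widen merge (prepend i<N t<N arc i≢t i∉ (fromT j<t))
      where
      t<N : t < N
      t<N = <-trans t<i i<N
      i∉ : ¬ Back t i
      i∉ (inj₁ i≤t) = <-irrefl refl (≤-<-trans i≤t t<i)
      i∉ (inj₂ i≤P) = <-irrefl refl (≤-<-trans i≤P P<i)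
      merge : ∀ {k} → k ≡ i ⊎ Back t k → Back i k
      merge (inj₁ refl)        = inj₁ ≤-refl
      merge (inj₂ (inj₁ k≤t)) = inj₁ (≤-trans k≤t (<⇒≤ t<i))
      merge (inj₂ (inj₂ k≤P)) = inj₂ k≤P
    ... | no j≮t = widen merge (prepend i<N t<N arc i≢t i∉ (forward t j (≮⇒≥ j≮t) (<-trans j<i i<N)))
      where
      t<N : t < N
      t<N = <-trans t<i i<N
      i∉ : ¬ (t ≤ i × i ≤ j)
      i∉ (_ , i≤j) = <-irrefl refl (≤-<-trans i≤j j<i)
      merge : ∀ {k} → k ≡ i ⊎ (t ≤ k × k ≤ j) → Back i k
      merge (inj₁ refl)      = inj₁ ≤-refl
      merge (inj₂ (_ , k≤j)) = inj₁ (≤-trans k≤j (<⇒≤ j<i))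

    backward : ∀ j → 1 ≤ j → ∀ i → i < N → j < i → Route (vertex i) (vertex j) (Back i)
    backward j 1≤j = <-rec _ go
      where
      go : ∀ i → (∀ {t} → t < i → t < N → j < t → Route (vertex t) (vertex j) (Back t)) →
           i < N → j < i → Route (vertex i) (vertex j) (Back i)
      go i rec i<N j<i with i ≤? P
      ... | yes i≤P = viaShortcut i j i<N i≤P 1≤j j<i
      ... | no  i≰P with wrap i (≰⇒> i≰P) i<N
      ... | t , t<i , i≢t , arc =
        viaWrap i j t i<N (≰⇒> i≰P) j<i t<i i≢t arc (rec t<i (<-trans t<i i<N))

    connects : ∀ i j → i < N → j < N → i ≢ j → PCPath D colouring (vertex i) (vertex j)
    connects i j i<N j<N i≢j with <-cmp i j
    ... | tri< i<j _ _ = toPCPath (forward i j (<⇒≤ i<j) j<N)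
    ... | tri≈ _ i≡j _ = ⊥-elim (i≢j i≡j)
    connects i zero    i<N _   _ | tri> _ _ 0<i   = toPCPath (toOrigin i 0<i i<N)
    connects i (suc j) i<N j<N _ | tri> _ _ 1+j<i = toPCPath (backward (suc j) (s≤s z≤n) i i<N 1+j<i)

    properlyConnected : ProperlyConnected D colouring
    properlyConnected u v u≢v =
      subst₂ (PCPath D colouring) (vertex-label u) (vertex-label v)
        (connects (label u) (label v) (label<N u) (label<N v)
          (λ e → u≢v (trans (sym (vertex-label u)) (trans (cong vertex e) (vertex-label v)))))

module ShortestEvenChord {m : ℕ} {D : Digraph (suc m)} (N-odd : Odd (suc m)) (C : HamCycle D)
                         (chord : (p : Fin (suc m)) → Σ (Fin (suc m)) λ q → EvenChord C p q) where
  open Cycle m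

  len : Fin N → ℕ
  len p = chordLength p (proj₁ (chord p))

  len-even : ∀ p → parity (len p) ≡ false
  len-even p = Even⇒parity≡false {len p} (proj₂ (proj₂ (proj₂ (proj₂ (chord p)))))

  2≤len : ∀ p → 2 ≤ len p
  2≤len p with chord p
  ... | q , _ , q≢p+1 , q≢p , _ with chordLength p q | advance-chordLength p q
  ...   | zero        | e = ⊥-elim (q≢p (sym e))
  ...   | suc zero    | e = ⊥-elim (q≢p+1 (sym e))
  ...   | suc (suc _) | _ = s≤s (s≤s z≤n)

  chord-arc : ∀ p → Arc D (x C p) (x C (advance (len p) p))
  chord-arc p = subst (λ q → Arc D (x C p) (x C q)) (sym (advance-chordLength p _)) (proj₁ (proj₂ (chord p)))

  shortest : Fin N
  shortest = proj₁ (argmin len)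

  L : ℕ
  L = len shortest

  -- y_P is the tail of the shortest chord and y₁ its head: P + L = N + 1.
  l : ℕ
  l = L ∸ 1

  P : ℕ
  P = N ∸ l

  U : Unrolling D
  U = unroll C (advance l shortest)

  open Unrolling U

  1+l≡L : suc l ≡ L
  1+l≡L = trans (+-comm 1 l) (m∸n+n≡m (≤-trans (s≤s z≤n) (2≤len shortest)))

  l≤N : l ≤ N
  l≤N = ≤-trans (n≤1+n l) (subst (_≤ N) (sym 1+l≡L) (<⇒≤ (chordLength<N shortest _)))

  P+L≡1+N : P + L ≡ suc N
  P+L≡1+N = trans (cong (P +_) (sym 1+l≡L)) (trans (+-suc P l) (cong suc (m∸n+n≡m l≤N)))

  P<N : P < N
  P<N = ≤-pred (subst₂ _≤_ (+-comm P 2) P+L≡1+N (+-monoʳ-≤ P (2≤len shortest)))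

  P-even : parity P ≡ false
  P-even = begin
    parity P       ≡⟨ parity-+-even P (len-even shortest) ⟨
    parity (P + L) ≡⟨ cong parity P+L≡1+N ⟩
    not (parity N) ≡⟨ cong not (Odd⇒parity≡true {N} N-odd) ⟩
    false          ∎
    where open ≡-Reasoning

  shortcut : Arc D (vertex P) (vertex 1)
  shortcut = subst₂ (Arc D) (sym vertex-P) (sym vertex-1) (chord-arc shortest)
    where
    vertex-P : vertex P ≡ x C shortest
    vertex-P = cong (x C) (trans (sym (advance-+ l P shortest))
                 (trans (cong (λ k → advance k shortest) (m+[n∸m]≡n l≤N)) (advance-N shortest)))
    vertex-1 : vertex 1 ≡ x C (advance L shortest)
    vertex-1 = cong (λ k → x C (advance k shortest)) 1+l≡L

  wrap : ∀ k → P < k → k < N → ∃[ t ] t < k × parity k ≢ parity t × Arc D (vertex k) (vertex t)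
  wrap k P<k k<N = k + Lk ∸ N , proj₁ jump , proj₂ jump , subst (Arc D (vertex k)) vertex-k+Lk arc
    where
    p : Fin N
    p = advance k (advance l shortest)
    Lk : ℕ
    Lk = len p
    Lk<N : Lk < N
    Lk<N = chordLength<N p _
    N≤k+Lk : N ≤ k + Lk
    N≤k+Lk = ≤-trans (n≤1+n N) (subst (_≤ k + Lk) P+L≡1+N (+-mono-≤ (<⇒≤ P<k) (proj₂ (argmin len) p)))
    arc : Arc D (vertex k) (vertex (k + Lk))
    arc = subst (λ q → Arc D (vertex k) (x C q)) (sym (advance-+ k Lk _)) (chord-arc p)
    vertex-k+Lk : vertex (k + Lk) ≡ vertex (k + Lk ∸ N)
    vertex-k+Lk = trans (cong vertex (sym (m∸n+n≡m N≤k+Lk))) (vertex-periodic (k + Lk ∸ N))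
    jump : k + Lk ∸ N < k × parity k ≢ parity (k + Lk ∸ N)
    jump = jump-past-period (Odd⇒parity≡true {N} N-odd) (len-even p) Lk<N N≤k+Lk

theorem3 : ∀ {m : ℕ} (D : Digraph (suc m)) → Odd (suc m) → (C : HamCycle D) →
    ((p : Fin (suc m)) → Σ (Fin (suc m)) λ q → EvenChord C p q) →
    pc≤ D 2
theorem3 D N-odd C chord = colouring , properlyConnected P P<N P-even shortcut wrap
  where
  open ShortestEvenChord N-odd C chord
  open ParityColouring U
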